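{- Let $n \ge 2$ be an integer. If there exists a multiplicative orthomorphism modulo $n$, then $n = 2$.
   Context: For an integer $n \ge 2$, a multiplicative orthomorphism modulo $n$ is a permutation $\sigma$ of $\{1, \dots, n-1\}$ such that the map $x \mapsto x\sigma(x) \bmod n$ is also a bijection of $\{1, \dots, n-1\}$ (residues taken in $\{0,\dots,n-1\}$). -}

module Defs where

open import Data.Nat using (ℕ; _*_; _≤_; _<_; NonZero)
open import Data.Nat.DivMod using (_%_)
open import Data.Product using (Σ; _×_)
open import Relation.Binary.PropositionalEquality using (_≡_)

InRange : ℕ → ℕ → Set
InRange n x = 1 ≤ x × x < n

IsBijectionOn : ℕ → (ℕ → ℕ) → Set
IsBijectionOn n f =
  (∀ x → InRange n x → InRange n (f x)) ×
  (∀ x y → InRange n x → InRange n y → f x ≡ f y → x ≡ y) ×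
  (∀ y → InRange n y → Σ ℕ (λ x → InRange n x × f x ≡ y))

IsMultOrthomorphism : (n : ℕ) .{{_ : NonZero n}} → (ℕ → ℕ) → Set
IsMultOrthomorphism n σ =
  IsBijectionOn n σ × IsBijectionOn n (λ x → (x * σ x) % n)

-- Let σ be one modulo n = N + 1 ≥ 3 and f x = x σ(x) mod n, so σ and f permute {1,…,N}.
--  (1) For a divisor q of n, q ∣ x and q ∣ σ x each imply q ∣ f x.  Since the identity, σ
--      and f all permute {1,…,N}, counting the x with q ∣ (·) yields the converses as well.
--  (2) If n = q m with 2 ≤ q ∣ m, then q ∣ σ m, so n ∣ m σ(m) and f m = 0: impossible.
--  (3) If n = p m with p an odd prime not dividing m, let Z be the product of the multiples
--      of m in {1,…,N}.  Reindexing along f and along σ gives Z ≡ Z² (mod n), hence mod p;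
--      but Z = ∏_{j<p} j m ≡ (p − 1)! ≡ −1 (mod p) by scaling and Wilson's theorem, and −1
--      is idempotent modulo p only when p = 2.
--  (4) Every n ≥ 3 has one of these two shapes (4 ∣ n or p² ∣ n give the first).

module Submission where

open import Defs
open import Level using (0ℓ)
open import Algebra.Bundles using (CommutativeMonoid)
open import Algebra.Structures using (IsCommutativeMonoid)
open import Data.Nat using (ℕ; zero; suc; _+_; _*_; _∸_; _≤_; _<_; z≤n; s≤s; NonZero; nonTrivial⇒n>1)
open import Data.Nat.Properties
open import Data.Nat.DivMod
open import Data.Nat.Divisibility
open import Data.Nat.Primality using (Prime; euclidsLemma; prime⇒nonTrivial)
open import Data.Nat.Primality.Factorisation using (factorise; PrimeFactorisation)
open import Data.Nat.ListAction using (product)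
open import Data.List using (List; []; _∷_)
open import Data.List.Relation.Unary.All using (All; []; _∷_)
open import Data.Fin using (Fin; toℕ; fromℕ<; punchOut)
open import Data.Fin.Properties using (toℕ-injective; toℕ<n; toℕ-fromℕ<; punchOut-injective; any?; injective⇒≤)
  renaming (_≟_ to _≟ᶠ_)
open import Data.Fin.Permutation using (Permutation; permutation)
open import Data.Empty using (⊥)
open import Data.Product using (Σ; _×_; _,_; proj₁; proj₂)
open import Data.Sum using (_⊎_; inj₁; inj₂)
open import Function.Definitions using (Injective)
open import Relation.Nullary using (Dec; yes; no; ¬_)
open import Relation.Nullary.Decidable using (_×-dec_)
open import Relation.Nullary.Negation using (contradiction)
open import Relation.Binary.PropositionalEquality

-- The range {1,…,N} is `InRange (suc N)`; moving between {1,…,N} and {1,…,N+1}.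
inRange-weaken : ∀ {n x} → InRange n x → InRange (suc n) x
inRange-weaken (1≤x , x<n) = 1≤x , m≤n⇒m≤1+n x<n

inRange-top : ∀ N → InRange (suc (suc N)) (suc N)
inRange-top N = s≤s z≤n , ≤-refl

inRange-split : ∀ {n x} → InRange (suc n) x → x ≡ n ⊎ InRange n x
inRange-split (1≤x , x<1+n) with m<1+n⇒m<n∨m≡n x<1+n
... | inj₁ x<n = inj₂ (1≤x , x<n)
... | inj₂ x≡n = inj₁ x≡n

-- h maps {1,…,n-1} injectively into itself (by finiteness, then also onto).
IsInjectionOn : ℕ → (ℕ → ℕ) → Set
IsInjectionOn n h =
  (∀ x → InRange n x → InRange n (h x)) ×
  (∀ x y → InRange n x → InRange n y → h x ≡ h y → x ≡ y)

bijection⇒injection : ∀ {n h} → IsBijectionOn n h → IsInjectionOn n h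
bijection⇒injection (into , inj , _) = into , inj

identity-injection : ∀ n → IsInjectionOn n (λ x → x)
identity-injection n = (λ x r → r) , (λ x y _ _ eq → eq)

injective⇒surjective : ∀ {n} (h : Fin n → Fin n) → Injective _≡_ _≡_ h →
                       ∀ y → Σ (Fin n) (λ x → h x ≡ y)
injective⇒surjective {zero} h inj ()
injective⇒surjective {suc n} h inj y with any? (λ x → h x ≟ᶠ y)
... | yes hit = hit
... | no miss = contradiction (injective⇒≤ {f = squeeze} squeeze-injective) (n≮n n)
  where
  -- If y is missed, h factors through Fin n, contradicting injectivity.
  avoids : ∀ x → y ≢ h x
  avoids x eq = miss (x , sym eq)
  squeeze : Fin (suc n) → Fin n
  squeeze x = punchOut (avoids x)
  squeeze-injective : Injective _≡_ _≡_ squeeze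
  squeeze-injective {a} {b} eq = inj (punchOut-injective (avoids a) (avoids b) eq)

fromFin : ∀ {N} → Fin N → ℕ
fromFin i = suc (toℕ i)

toFin : ∀ N x → InRange (suc N) x → Fin N
toFin N (suc x) (_ , s≤s x<N) = fromℕ< x<N

fromFin-toFin : ∀ N x (r : InRange (suc N) x) → fromFin (toFin N x r) ≡ x
fromFin-toFin N (suc x) (_ , s≤s x<N) = cong suc (toℕ-fromℕ< x<N)

fromFin-inRange : ∀ {N} (i : Fin N) → InRange (suc N) (fromFin i)
fromFin-inRange i = s≤s z≤n , s≤s (toℕ<n i)

fromFin-injective : ∀ {N} {i j : Fin N} → fromFin i ≡ fromFin j → i ≡ j
fromFin-injective eq = toℕ-injective (suc-injective eq)

module RangePermutation (N : ℕ) (h : ℕ → ℕ) (h-inj : IsInjectionOn (suc N) h) where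

  hᶠ : Fin N → Fin N
  hᶠ i = toFin N (h (fromFin i)) (proj₁ h-inj _ (fromFin-inRange i))

  fromFin-hᶠ : ∀ i → fromFin (hᶠ i) ≡ h (fromFin i)
  fromFin-hᶠ i = fromFin-toFin N _ (proj₁ h-inj _ (fromFin-inRange i))

  hᶠ-injective : Injective _≡_ _≡_ hᶠ
  hᶠ-injective {i} {j} eq = fromFin-injective
    (proj₂ h-inj _ _ (fromFin-inRange i) (fromFin-inRange j)
      (trans (sym (fromFin-hᶠ i)) (trans (cong fromFin eq) (fromFin-hᶠ j))))

  preimage : ∀ i → Σ (Fin N) (λ j → hᶠ j ≡ i)
  preimage = injective⇒surjective hᶠ hᶠ-injective

  π : Permutation N N
  π = permutation hᶠ (λ i → proj₁ (preimage i)) (λ i → proj₂ (preimage i))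
                  (λ i → hᶠ-injective (proj₂ (preimage (hᶠ i))))

  onto : ∀ y → InRange (suc N) y → Σ ℕ (λ x → InRange (suc N) x × h x ≡ y)
  onto y r = fromFin j , fromFin-inRange j ,
             trans (sym (fromFin-hᶠ j)) (trans (cong fromFin (proj₂ (preimage yᶠ))) (fromFin-toFin N y r))
    where
    yᶠ : Fin N
    yᶠ = toFin N y r
    j : Fin N
    j = proj₁ (preimage yᶠ)

module RangeFold {A : Set} (_∙_ : A → A → A) (ε : A) (isCM : IsCommutativeMonoid _≡_ _∙_ ε) where

  open IsCommutativeMonoid isCM using (assoc; comm; identityˡ; identityʳ)
  open ≡-Reasoning

  fold : ℕ → (ℕ → A) → A
  fold zero g = ε
  fold (suc N) g = fold N g ∙ g (suc N)

  cong-on : ∀ N {g g′} → (∀ x → InRange (suc N) x → g x ≡ g′ x) → fold N g ≡ fold N g′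
  cong-on zero eq = refl
  cong-on (suc N) eq = cong₂ _∙_ (cong-on N (λ x r → eq x (inRange-weaken r))) (eq (suc N) (inRange-top N))

  trivial-on : ∀ N {g} → (∀ x → InRange (suc N) x → g x ≡ ε) → fold N g ≡ ε
  trivial-on zero eq = refl
  trivial-on (suc N) eq = trans (cong₂ _∙_ (trivial-on N (λ x r → eq x (inRange-weaken r))) (eq (suc N) (inRange-top N)))
                                (identityˡ ε)

  distrib : ∀ N g g′ → fold N (λ x → g x ∙ g′ x) ≡ fold N g ∙ fold N g′
  distrib zero g g′ = sym (identityˡ ε)
  distrib (suc N) g g′ = begin
    fold N (λ x → g x ∙ g′ x) ∙ (g (suc N) ∙ g′ (suc N))  ≡⟨ cong (_∙ _) (distrib N g g′) ⟩
    (G ∙ G′) ∙ (g (suc N) ∙ g′ (suc N))                  ≡⟨ assoc G G′ _ ⟩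
    G ∙ (G′ ∙ (g (suc N) ∙ g′ (suc N)))                  ≡⟨ cong (G ∙_) (sym (assoc G′ _ _)) ⟩
    G ∙ ((G′ ∙ g (suc N)) ∙ g′ (suc N))                  ≡⟨ cong (λ t → G ∙ (t ∙ g′ (suc N))) (comm G′ _) ⟩
    G ∙ ((g (suc N) ∙ G′) ∙ g′ (suc N))                  ≡⟨ cong (G ∙_) (assoc _ G′ _) ⟩
    G ∙ (g (suc N) ∙ (G′ ∙ g′ (suc N)))                  ≡⟨ sym (assoc G _ _) ⟩
    (G ∙ g (suc N)) ∙ (G′ ∙ g′ (suc N))                  ∎
    where
    G G′ : A
    G = fold N g
    G′ = fold N g′

  split : ∀ a b g → fold (a + b) g ≡ fold a g ∙ fold b (λ x → g (a + x))
  split a zero g rewrite +-identityʳ a = sym (identityʳ (fold a g))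
  split a (suc b) g rewrite +-suc a b =
    trans (cong (_∙ g (suc (a + b))) (split a b g)) (assoc (fold a g) _ _)

  dropAt : (ℕ → A) → ℕ → ℕ → A
  dropAt g j x with x ≟ j
  ... | yes _ = ε
  ... | no _ = g x

  dropAt-here : ∀ g j → dropAt g j j ≡ ε
  dropAt-here g j with j ≟ j
  ... | yes _ = refl
  ... | no j≢j = contradiction refl j≢j

  dropAt-else : ∀ g {j x} → x ≢ j → dropAt g j x ≡ g x
  dropAt-else g {j} {x} x≢j with x ≟ j
  ... | yes x≡j = contradiction x≡j x≢j
  ... | no _ = refl

  extract : ∀ N g {j} → InRange (suc N) j → fold N g ≡ g j ∙ fold N (dropAt g j)
  extract zero g (s≤s z≤n , s≤s ())
  extract (suc N) g {j} r with inRange-split r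
  ... | inj₁ refl = begin
    fold N g ∙ g (suc N)                    ≡⟨ cong (_∙ g (suc N)) (cong-on N unchanged) ⟩
    fold N (dropAt g j) ∙ g (suc N)         ≡⟨ comm _ _ ⟩
    g j ∙ fold N (dropAt g j)               ≡⟨ cong (g j ∙_) (sym (identityʳ _)) ⟩
    g j ∙ (fold N (dropAt g j) ∙ ε)         ≡⟨ cong (λ t → g j ∙ (fold N (dropAt g j) ∙ t)) (sym (dropAt-here g j)) ⟩
    g j ∙ fold (suc N) (dropAt g j)         ∎
    where
    unchanged : ∀ x → InRange (suc N) x → g x ≡ dropAt g j x
    unchanged x (_ , x<j) = sym (dropAt-else g (<⇒≢ x<j))
  ... | inj₂ r′ = begin
    fold N g ∙ g (suc N)                                ≡⟨ cong (_∙ g (suc N)) (extract N g r′) ⟩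
    (g j ∙ fold N (dropAt g j)) ∙ g (suc N)             ≡⟨ assoc (g j) _ _ ⟩
    g j ∙ (fold N (dropAt g j) ∙ g (suc N))             ≡⟨ cong (λ t → g j ∙ (fold N (dropAt g j) ∙ t)) (sym (dropAt-else g top≢j)) ⟩
    g j ∙ fold (suc N) (dropAt g j)                     ∎
    where
    top≢j : suc N ≢ j
    top≢j eq = <⇒≢ (proj₂ r′) (sym eq)

  private
    CM : CommutativeMonoid 0ℓ 0ℓ
    CM = record { Carrier = A ; _≈_ = _≡_ ; _∙_ = _∙_ ; ε = ε ; isCommutativeMonoid = isCM }
    open import Algebra.Properties.CommutativeMonoid.Sum CM using (sum; sum-permute; sum-cong-≗)

    fold-suc : ∀ N g → fold (suc N) g ≡ g 1 ∙ fold N (λ x → g (suc x))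
    fold-suc zero g = trans (identityˡ (g 1)) (sym (identityʳ (g 1)))
    fold-suc (suc N) g = trans (cong (_∙ g (suc (suc N))) (fold-suc N g)) (assoc (g 1) _ _)

    fold≡sum : ∀ N g → fold N g ≡ sum (λ (i : Fin N) → g (fromFin i))
    fold≡sum zero g = refl
    fold≡sum (suc N) g = trans (fold-suc N g) (cong (g 1 ∙_) (fold≡sum N (λ x → g (suc x))))

  reindex : ∀ N {h} → IsInjectionOn (suc N) h → ∀ g → fold N (λ x → g (h x)) ≡ fold N g
  reindex N {h} h-inj g = begin
    fold N (λ x → g (h x))                  ≡⟨ fold≡sum N (λ x → g (h x)) ⟩
    sum {N} (λ i → g (h (fromFin i)))       ≡⟨ sum-cong-≗ (λ i → cong g (sym (fromFin-hᶠ i))) ⟩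
    sum {N} (λ i → g (fromFin (hᶠ i)))      ≡⟨ sym (sum-permute (λ i → g (fromFin i)) π) ⟩
    sum {N} (λ i → g (fromFin i))           ≡⟨ sym (fold≡sum N g) ⟩
    fold N g                                ∎
    where open RangePermutation N h h-inj

module ∏ = RangeFold _*_ 1 *-1-isCommutativeMonoid
module ∑ = RangeFold _+_ 0 +-0-isCommutativeMonoid
open ∏ using () renaming (fold to ∏)
open ∑ using () renaming (fold to ∑)

𝟙 : ∀ {A : Set} → Dec A → ℕ
𝟙 (yes _) = 1
𝟙 (no _) = 0

𝟙-mono : ∀ {A B : Set} (a : Dec A) (b : Dec B) → (A → B) → 𝟙 a ≤ 𝟙 b
𝟙-mono (yes _) (yes _) _ = ≤-refl
𝟙-mono (yes x) (no ¬y) imp = contradiction (imp x) ¬y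
𝟙-mono (no _) _ _ = z≤n

𝟙-reflects : ∀ {A B : Set} (a : Dec A) (b : Dec B) → 𝟙 a ≡ 𝟙 b → A → B
𝟙-reflects _ (yes y) _ _ = y
𝟙-reflects (yes _) (no _) () _
𝟙-reflects (no ¬x) (no _) _ x = contradiction x ¬x

+-equal⇒equal : ∀ {x y u v} → x ≤ y → u ≤ v → x + u ≡ y + v → x ≡ y × u ≡ v
+-equal⇒equal {x} {y} {u} {v} x≤y u≤v eq =
  ≤-antisym x≤y (+-cancelʳ-≤ v y x (≤-trans (≤-reflexive (sym eq)) (+-monoʳ-≤ x u≤v))) ,
  ≤-antisym u≤v (+-cancelˡ-≤ y v u (≤-trans (≤-reflexive (sym eq)) (+-monoˡ-≤ u x≤y)))

∑-mono : ∀ N {a b} → (∀ x → InRange (suc N) x → a x ≤ b x) → ∑ N a ≤ ∑ N b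
∑-mono zero _ = z≤n
∑-mono (suc N) le = +-mono-≤ (∑-mono N (λ x r → le x (inRange-weaken r))) (le (suc N) (inRange-top N))

∑-equal⇒pointwise : ∀ N {a b} → (∀ x → InRange (suc N) x → a x ≤ b x) → ∑ N a ≡ ∑ N b →
                    ∀ x → InRange (suc N) x → a x ≡ b x
∑-equal⇒pointwise zero _ _ x (s≤s z≤n , s≤s ())
∑-equal⇒pointwise (suc N) le eq x r
  with +-equal⇒equal (∑-mono N (λ y s → le y (inRange-weaken s))) (le (suc N) (inRange-top N)) eq
     | inRange-split r
... | _ , top-eq | inj₁ refl = top-eq
... | lower-eq , _ | inj₂ r′ = ∑-equal⇒pointwise N (λ y s → le y (inRange-weaken s)) lower-eq x r′

-- Counting: if h, k permute {1,…,N} and P (h x) implies P (k x) everywhere, the converse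
-- implication also holds, since P ∘ h and P ∘ k both hold exactly #{x : P x} times.
counting-converse : ∀ N {P : ℕ → Set} (P? : ∀ y → Dec (P y)) {h k} →
  IsInjectionOn (suc N) h → IsInjectionOn (suc N) k →
  (∀ x → InRange (suc N) x → P (h x) → P (k x)) →
  ∀ x → InRange (suc N) x → P (k x) → P (h x)
counting-converse N P? {h} {k} h-inj k-inj forward x r =
  𝟙-reflects (P? (k x)) (P? (h x))
    (sym (∑-equal⇒pointwise N (λ y s → 𝟙-mono (P? (h y)) (P? (k y)) (forward y s)) same-count x r))
  where
  same-count : ∑ N (λ y → 𝟙 (P? (h y))) ≡ ∑ N (λ y → 𝟙 (P? (k y)))
  same-count = trans (∑.reindex N h-inj (λ y → 𝟙 (P? y))) (sym (∑.reindex N k-inj (λ y → 𝟙 (P? y))))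

%≡⇒∣∸ : ∀ d .{{_ : NonZero d}} {a b} → a % d ≡ b % d → d ∣ b ∸ a
%≡⇒∣∸ d {a} {b} eq = divides (b / d ∸ a / d) (begin
    b ∸ a                                              ≡⟨ cong₂ _∸_ (m≡m%n+[m/n]*n b d) (m≡m%n+[m/n]*n a d) ⟩
    (b % d + (b / d) * d) ∸ (a % d + (a / d) * d)      ≡⟨ cong (λ t → (b % d + (b / d) * d) ∸ (t + (a / d) * d)) eq ⟩
    (b % d + (b / d) * d) ∸ (b % d + (a / d) * d)      ≡⟨ [m+n]∸[m+o]≡n∸o (b % d) _ _ ⟩
    (b / d) * d ∸ (a / d) * d                          ≡⟨ sym (*-distribʳ-∸ d (b / d) (a / d)) ⟩
    (b / d ∸ a / d) * d                                ∎)
  where open ≡-Reasoning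

∣∸⇒%≡ : ∀ d .{{_ : NonZero d}} {a b} → a ≤ b → d ∣ b ∸ a → a % d ≡ b % d
∣∸⇒%≡ d {a} a≤b d∣b∸a = trans (sym (%-remove-+ʳ a d∣b∸a)) (cong (_% d) (m+[n∸m]≡n a≤b))

%-injective-below : ∀ {d a b} .{{_ : NonZero d}} → a < d → b < d → a % d ≡ b % d → a ≡ b
%-injective-below a<d b<d eq = trans (sym (m<n⇒m%n≡m a<d)) (trans eq (m<n⇒m%n≡m b<d))

%≡-divisor : ∀ {d n} .{{_ : NonZero d}} .{{_ : NonZero n}} → d ∣ n → ∀ {a b} → a % n ≡ b % n → a % d ≡ b % d
%≡-divisor {d} {n} d∣n {a} {b} eq =
  trans (sym (m∣n⇒o%n%m≡o%m d n a d∣n)) (trans (cong (_% d) eq) (m∣n⇒o%n%m≡o%m d n b d∣n))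

∏-cong-mod : ∀ d .{{_ : NonZero d}} N {a b} → (∀ x → InRange (suc N) x → a x % d ≡ b x % d) → ∏ N a % d ≡ ∏ N b % d
∏-cong-mod d zero _ = refl
∏-cong-mod d (suc N) {a} {b} eq = begin
    (∏ N a * a (suc N)) % d                  ≡⟨ %-distribˡ-* (∏ N a) (a (suc N)) d ⟩
    ((∏ N a % d) * (a (suc N) % d)) % d      ≡⟨ cong₂ (λ u v → (u * v) % d) (∏-cong-mod d N (λ x r → eq x (inRange-weaken r)))
                                                                            (eq (suc N) (inRange-top N)) ⟩
    ((∏ N b % d) * (b (suc N) % d)) % d      ≡⟨ sym (%-distribˡ-* (∏ N b) (b (suc N)) d) ⟩
    (∏ N b * b (suc N)) % d                  ∎
  where open ≡-Reasoning

inRange⇒∤ : ∀ {d x} → InRange d x → ¬ d ∣ x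
inRange⇒∤ {d} {suc x} (_ , x<d) d∣x = <⇒≱ x<d (∣⇒≤ d∣x)

module Pairing (d : ℕ) .{{_ : NonZero d}} where

  record IsPartner (B : ℕ) (g ι : ℕ → ℕ) (x : ℕ) : Set where
    field
      inRange    : InRange (suc B) (ι x)
      distinct   : ι x ≢ x
      involutive : ι (ι x) ≡ x
      nontrivial : g (ι x) ≢ 1
      inverts    : (g x * g (ι x)) % d ≡ 1 % d

  PairedOn : ℕ → (ℕ → ℕ) → (ℕ → ℕ) → Set
  PairedOn B g ι = ∀ x → InRange (suc B) x → g x ≢ 1 → IsPartner B g ι x

  -- A trivial top factor can be dropped: no partner is the top.
  drop-trivial-top : ∀ B {g ι} → PairedOn (suc B) g ι → g (suc B) ≡ 1 → PairedOn B g ι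
  drop-trivial-top B {g} {ι} paired top≡1 x r gx≢1 = record
      { inRange = restricted ; distinct = distinct ; involutive = involutive
      ; nontrivial = nontrivial ; inverts = inverts }
    where
    partner : IsPartner (suc B) g ι x
    partner = paired x (inRange-weaken r) gx≢1
    open IsPartner partner
    restricted : InRange (suc B) (ι x)
    restricted with inRange-split inRange
    ... | inj₁ ιx≡top = contradiction (trans (cong g ιx≡top) top≡1) nontrivial
    ... | inj₂ r′ = r′

  drop-top-pair : ∀ B {g ι} → PairedOn (suc B) g ι → g (suc B) ≢ 1 →
                  PairedOn B (∏.dropAt g (ι (suc B))) ι
  drop-top-pair B {g} {ι} paired top≢1 x r g′x≢1 = record
      { inRange = restricted ; distinct = distinct ; involutive = involutive
      ; nontrivial = λ eq → nontrivial (trans (sym (∏.dropAt-else g ιx≢j)) eq)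
      ; inverts = trans (cong₂ (λ u v → (u * v) % d) (∏.dropAt-else g x≢j) (∏.dropAt-else g ιx≢j)) inverts }
    where
    j : ℕ
    j = ι (suc B)
    x≢j : x ≢ j
    x≢j refl = g′x≢1 (∏.dropAt-here g j)
    partner : IsPartner (suc B) g ι x
    partner = paired x (inRange-weaken r) (λ eq → g′x≢1 (trans (∏.dropAt-else g x≢j) eq))
    open IsPartner partner
    ιtop-involutive : ι j ≡ suc B
    ιtop-involutive = IsPartner.involutive (paired (suc B) (inRange-top B) top≢1)
    ιx≢j : ι x ≢ j
    ιx≢j eq = <⇒≢ (proj₂ r) (trans (sym involutive) (trans (cong ι eq) ιtop-involutive))
    restricted : InRange (suc B) (ι x)
    restricted with inRange-split inRange
    ... | inj₁ ιx≡top = contradiction (trans (sym involutive) (cong ι ιx≡top)) x≢j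
    ... | inj₂ r′ = r′

  paired-product : ∀ B g ι → PairedOn B g ι → ∏ B g % d ≡ 1 % d
  paired-product zero g ι _ = refl
  paired-product (suc B) g ι paired with g (suc B) ≟ 1
  ... | yes top≡1 = begin
    (∏ B g * g (suc B)) % d    ≡⟨ cong (λ t → (∏ B g * t) % d) top≡1 ⟩
    (∏ B g * 1) % d            ≡⟨ cong (_% d) (*-identityʳ (∏ B g)) ⟩
    ∏ B g % d                  ≡⟨ paired-product B g ι (drop-trivial-top B paired top≡1) ⟩
    1 % d                      ∎
    where open ≡-Reasoning
  ... | no top≢1 = begin
    (∏ B g * g b) % d                          ≡⟨ cong (λ t → (t * g b) % d) (∏.extract B g j-inRange) ⟩
    ((g j * rest) * g b) % d                   ≡⟨ cong (_% d) (trans (*-comm (g j * rest) (g b)) (sym (*-assoc (g b) (g j) rest))) ⟩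
    ((g b * g j) * rest) % d                   ≡⟨ %-distribˡ-* (g b * g j) rest d ⟩
    (((g b * g j) % d) * (rest % d)) % d       ≡⟨ cong₂ (λ u v → (u * v) % d) (IsPartner.inverts top-partner)
                                                      (paired-product B (∏.dropAt g j) ι (drop-top-pair B paired top≢1)) ⟩
    ((1 % d) * (1 % d)) % d                    ≡⟨ sym (%-distribˡ-* 1 1 d) ⟩
    1 % d                                      ∎
    where
    open ≡-Reasoning
    b j rest : ℕ
    b = suc B
    j = ι b
    rest = ∏ B (∏.dropAt g j)
    top-partner : IsPartner (suc B) g ι b
    top-partner = paired b (inRange-top B) top≢1
    j-inRange : InRange (suc B) j
    j-inRange with inRange-split (IsPartner.inRange top-partner)
    ... | inj₁ j≡b = contradiction j≡b (IsPartner.distinct top-partner)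
    ... | inj₂ r = r

square∸1 : ∀ x → x * x ∸ 1 ≡ (x ∸ 1) * suc x
square∸1 zero = refl
square∸1 (suc y) = sym (*-suc y (suc y))

module ModPrime (M : ℕ) (p-prime : Prime (suc (suc M))) where

  P p : ℕ
  P = suc M
  p = suc P

  1<p : 1 < p
  1<p = s≤s (s≤s z≤n)

  P-inRange : InRange p P
  P-inRange = s≤s z≤n , ≤-refl

  1-inRange : InRange p 1
  1-inRange = ≤-refl , 1<p

  cancel≤ : ∀ {x a b} → ¬ p ∣ x → a ≤ b → (x * a) % p ≡ (x * b) % p → a % p ≡ b % p
  cancel≤ {x} {a} {b} p∤x a≤b eq
    with euclidsLemma x (b ∸ a) p-prime (subst (p ∣_) (sym (*-distribˡ-∸ x b a)) (%≡⇒∣∸ p {x * a} {x * b} eq))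
  ... | inj₁ p∣x = contradiction p∣x p∤x
  ... | inj₂ p∣b∸a = ∣∸⇒%≡ p a≤b p∣b∸a

  cancel : ∀ {x} a b → ¬ p ∣ x → (x * a) % p ≡ (x * b) % p → a % p ≡ b % p
  cancel a b p∤x eq with ≤-total a b
  ... | inj₁ a≤b = cancel≤ p∤x a≤b eq
  ... | inj₂ b≤a = sym (cancel≤ p∤x b≤a (sym eq))

  mul-into : ∀ {x} → ¬ p ∣ x → ∀ k → InRange p k → InRange p ((x * k) % p)
  mul-into {x} p∤x k rk = nonzero , m%n<n (x * k) p
    where
    nonzero : 1 ≤ (x * k) % p
    nonzero with (x * k) % p in eq
    ... | suc _ = s≤s z≤n
    ... | zero with euclidsLemma x k p-prime (m%n≡0⇒n∣m (x * k) p eq)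
    ...   | inj₁ p∣x = contradiction p∣x p∤x
    ...   | inj₂ p∣k = contradiction p∣k (inRange⇒∤ rk)

  mul-injection : ∀ {x} → ¬ p ∣ x → IsInjectionOn p (λ k → (x * k) % p)
  mul-injection p∤x = mul-into p∤x ,
    λ k k′ rk rk′ eq → %-injective-below (proj₂ rk) (proj₂ rk′) (cancel k k′ p∤x eq)

  square≡1 : ∀ {x} → InRange p x → (x * x) % p ≡ 1 % p → x ≡ 1 ⊎ x ≡ P
  square≡1 {suc y} (_ , x<p) eq
    with euclidsLemma y (suc (suc y)) p-prime (subst (p ∣_) (square∸1 (suc y)) (%≡⇒∣∸ p {1} {suc y * suc y} (sym eq)))
  ... | inj₁ p∣y = inj₁ (cong suc (%-injective-below (<-trans (n<1+n y) x<p) (s≤s z≤n)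
                                      (n∣m⇒m%n≡0 y p p∣y)))
  ... | inj₂ p∣y+2 = inj₂ (suc-injective (≤-antisym x<p (∣⇒≤ p∣y+2)))

  P-squared : (P * P) % p ≡ 1 % p
  P-squared = sym (∣∸⇒%≡ p {1} {P * P} (s≤s z≤n) (subst (p ∣_) (sym (square∸1 P)) (n∣m*n M)))

  -- The inverse of a nonzero residue, which exists as multiplication by it is onto.
  inRange? : ∀ x → Dec (InRange p x)
  inRange? x = (1 ≤? x) ×-dec (x <? p)

  inverse-of : ∀ x → InRange p x → Σ ℕ (λ y → InRange p y × (x * y) % p ≡ 1)
  inverse-of x rx = RangePermutation.onto P (λ k → (x * k) % p) (mul-injection (inRange⇒∤ rx)) 1 1-inRange

  inverse : ℕ → ℕ
  inverse x with inRange? x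
  ... | yes rx = proj₁ (inverse-of x rx)
  ... | no _ = 0

  inverse-spec : ∀ {x} → InRange p x → InRange p (inverse x) × (x * inverse x) % p ≡ 1 % p
  inverse-spec {x} rx with inRange? x
  ... | no ¬rx = contradiction rx ¬rx
  ... | yes rx′ = proj₁ (proj₂ (inverse-of x rx′)) , trans (proj₂ (proj₂ (inverse-of x rx′))) (sym (m<n⇒m%n≡m 1<p))

  inverse-paired : Pairing.PairedOn p M (λ x → x) inverse
  inverse-paired x r x≢1 = record
    { inRange = below-P ; distinct = distinct ; involutive = involutive
    ; nontrivial = nontrivial ; inverts = xy≡1 }
    where
    rx : InRange p x
    rx = inRange-weaken r
    y : ℕ
    y = inverse x
    ry : InRange p y
    ry = proj₁ (inverse-spec rx)
    xy≡1 : (x * y) % p ≡ 1 % p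
    xy≡1 = proj₂ (inverse-spec rx)
    x≢P : x ≢ P
    x≢P = <⇒≢ (proj₂ r)
    below-P : InRange P y
    below-P with inRange-split ry
    ... | inj₂ r′ = r′
    ... | inj₁ y≡P = contradiction (proj₂ (mul-injection (inRange⇒∤ P-inRange)) x P rx P-inRange (begin
        (P * x) % p    ≡⟨ cong (_% p) (*-comm P x) ⟩
        (x * P) % p    ≡⟨ cong (λ t → (x * t) % p) (sym y≡P) ⟩
        (x * y) % p    ≡⟨ xy≡1 ⟩
        1 % p          ≡⟨ sym P-squared ⟩
        (P * P) % p    ∎)) x≢P
      where open ≡-Reasoning
    distinct : y ≢ x
    distinct y≡x with square≡1 rx (trans (cong (λ t → (x * t) % p) (sym y≡x)) xy≡1)
    ... | inj₁ x≡1 = x≢1 x≡1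
    ... | inj₂ x≡P = x≢P x≡P
    involutive : inverse y ≡ x
    involutive = proj₂ (mul-injection (inRange⇒∤ ry)) _ _ (proj₁ (inverse-spec ry)) rx
      (trans (proj₂ (inverse-spec ry)) (trans (sym xy≡1) (cong (_% p) (*-comm x y))))
    nontrivial : y ≢ 1
    nontrivial y≡1 = x≢1 (%-injective-below (proj₂ rx) 1<p
      (trans (cong (_% p) (sym (*-identityʳ x))) (trans (cong (λ t → (x * t) % p) (sym y≡1)) xy≡1)))

  wilson : ∏ P (λ x → x) % p ≡ P % p
  wilson = begin
    (∏ M (λ x → x) * P) % p                   ≡⟨ %-distribˡ-* (∏ M (λ x → x)) P p ⟩
    ((∏ M (λ x → x) % p) * (P % p)) % p       ≡⟨ cong (λ t → (t * (P % p)) % p)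
                                                     (Pairing.paired-product p M (λ x → x) inverse inverse-paired) ⟩
    ((1 % p) * (P % p)) % p                   ≡⟨ sym (%-distribˡ-* 1 P p) ⟩
    (1 * P) % p                               ≡⟨ cong (_% p) (*-identityˡ P) ⟩
    P % p                                     ∎
    where open ≡-Reasoning

  ∏-scaled : ∀ {m} → ¬ p ∣ m → ∏ P (λ j → j * m) % p ≡ ∏ P (λ j → j) % p
  ∏-scaled {m} p∤m =
    trans (∏-cong-mod p P (λ j _ → trans (cong (_% p) (*-comm j m)) (sym (m%n%n≡m%n (m * j) p))))
          (cong (_% p) (∏.reindex P (mul-injection p∤m) (λ j → j)))

  minus-one-idempotent : ∀ a → a % p ≡ P % p → a % p ≡ (a * a) % p → P ≡ 1
  minus-one-idempotent a a≡P a≡a² = %-injective-below ≤-refl 1<p (trans (sym a≡P) a≡1)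
    where
    p∤a : ¬ p ∣ a
    p∤a p∣a = inRange⇒∤ P-inRange (m%n≡0⇒n∣m P p (trans (sym a≡P) (n∣m⇒m%n≡0 a p p∣a)))
    a≡1 : a % p ≡ 1 % p
    a≡1 = cancel a 1 p∤a (trans (sym a≡a²) (cong (_% p) (sym (*-identityʳ a))))

onMultiples : ℕ → ℕ → ℕ
onMultiples m x with m ∣? x
... | yes _ = x
... | no _ = 1

onMultiples-yes : ∀ {m x} → m ∣ x → onMultiples m x ≡ x
onMultiples-yes {m} {x} m∣x with m ∣? x
... | yes _ = refl
... | no m∤x = contradiction m∣x m∤x

onMultiples-no : ∀ {m x} → ¬ m ∣ x → onMultiples m x ≡ 1
onMultiples-no {m} {x} m∤x with m ∣? x
... | yes m∣x = contradiction m∣x m∤x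
... | no _ = refl

module Multiples (m′ : ℕ) where

  m : ℕ
  m = suc m′

  ∏-tail : ∀ k r → r < m → ∏ (k * m + r) (onMultiples m) ≡ ∏ (k * m) (onMultiples m)
  ∏-tail k r r<m = begin
    ∏ (k * m + r) (onMultiples m)                                            ≡⟨ ∏.split (k * m) r (onMultiples m) ⟩
    ∏ (k * m) (onMultiples m) * ∏ r (λ x → onMultiples m (k * m + x))        ≡⟨ cong (∏ (k * m) (onMultiples m) *_)
                                                                                   (∏.trivial-on r (λ x rx → onMultiples-no (not-multiple x rx))) ⟩
    ∏ (k * m) (onMultiples m) * 1                                            ≡⟨ *-identityʳ _ ⟩
    ∏ (k * m) (onMultiples m)                                                ∎
    where
    open ≡-Reasoning
    not-multiple : ∀ x → InRange (suc r) x → ¬ m ∣ k * m + x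
    not-multiple x (1≤x , x≤r) m∣ = inRange⇒∤ (1≤x , ≤-trans x≤r r<m) (∣m+n∣m⇒∣n m∣ (n∣m*n k))

  ∏-multiples : ∀ k → ∏ (k * m) (onMultiples m) ≡ ∏ k (λ j → j * m)
  ∏-multiples zero = refl
  ∏-multiples (suc k) = begin
    ∏ (suc k * m) (onMultiples m)                                           ≡⟨ cong (λ t → ∏ t (onMultiples m)) (sym top) ⟩
    ∏ (k * m + m′) (onMultiples m) * onMultiples m (suc (k * m + m′))      ≡⟨ cong₂ _*_ (∏-tail k m′ ≤-refl)
                                                                                 (trans (cong (onMultiples m) top) (onMultiples-yes (n∣m*n (suc k)))) ⟩
    ∏ (k * m) (onMultiples m) * (suc k * m)                                 ≡⟨ cong (_* (suc k * m)) (∏-multiples k) ⟩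
    ∏ k (λ j → j * m) * (suc k * m)                                         ∎
    where
    open ≡-Reasoning
    top : suc (k * m + m′) ≡ suc k * m
    top = cong suc (+-comm (k * m) m′)

prime⇒≥2 : ∀ {p} → Prime p → 2 ≤ p
prime⇒≥2 {p} p-prime = nonTrivial⇒n>1 p {{prime⇒nonTrivial p-prime}}

halve-≥3 : ∀ r → ¬ 4 ∣ 2 * r → 3 ≤ 2 * r → 3 ≤ r
halve-≥3 (suc (suc zero)) 4∤4 _ = contradiction (divides 1 refl) 4∤4
halve-≥3 (suc (suc (suc r))) _ _ = s≤s (s≤s (s≤s z≤n))
halve-≥3 (suc zero) _ (s≤s (s≤s ()))

odd-prime-factor : ∀ (ps : List ℕ) → All Prime ps → ¬ 4 ∣ product ps → 3 ≤ product ps →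
                   Σ ℕ λ p → Prime p × 3 ≤ p × p ∣ product ps
odd-prime-factor [] [] _ (s≤s ())
odd-prime-factor (a ∷ ps) (a-prime ∷ primes) 4∤ 3≤ with a ≟ 2
... | no a≢2 = a , a-prime , ≤∧≢⇒< (prime⇒≥2 a-prime) (λ eq → a≢2 (sym eq)) , m∣m*n (product ps)
... | yes refl with odd-prime-factor ps primes (λ 4∣ → 4∤ (∣n⇒∣m*n 2 4∣)) (halve-≥3 (product ps) 4∤ 3≤)
...   | p , p-prime , 3≤p , p∣ = p , p-prime , 3≤p , ∣n⇒∣m*n 2 p∣

odd-prime-divisor : ∀ n → 3 ≤ n → ¬ 4 ∣ n → Σ ℕ λ p → Prime p × 3 ≤ p × p ∣ n
odd-prime-divisor n@(suc _) 3≤n 4∤n with odd-prime-factor factors factorsPrime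
                                   (λ 4∣ → 4∤n (subst (4 ∣_) (sym isFactorisation) 4∣))
                                   (subst (3 ≤_) isFactorisation 3≤n)
  where open PrimeFactorisation (factorise n)
... | p , p-prime , 3≤p , p∣ = p , p-prime , 3≤p , subst (p ∣_) (sym isFactorisation) p∣
  where open PrimeFactorisation (factorise n)

data Shape (n : ℕ) : Set where
  squareful      : ∀ {q m} → 2 ≤ q → q ∣ m → q * m ≡ n → Shape n
  odd-prime-part : ∀ {p m} → Prime p → 3 ≤ p → ¬ p ∣ m → p * m ≡ n → Shape n

shape : ∀ n → 3 ≤ n → Shape n
shape n 3≤n with 4 ∣? n
... | yes (divides k n≡k*4) = squareful {q = 2} {m = k * 2} (s≤s (s≤s z≤n)) (n∣m*n k) (begin
    2 * (k * 2)   ≡⟨ *-comm 2 (k * 2) ⟩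
    k * 2 * 2     ≡⟨ *-assoc k 2 2 ⟩
    k * 4         ≡⟨ sym n≡k*4 ⟩
    n             ∎)
  where open ≡-Reasoning
... | no 4∤n with odd-prime-divisor n 3≤n 4∤n
...   | p , p-prime , 3≤p , divides m n≡m*p with p ∣? m
...     | yes p∣m = squareful (prime⇒≥2 p-prime) p∣m (trans (*-comm p m) (sym n≡m*p))
...     | no p∤m = odd-prime-part p-prime 3≤p p∤m (trans (*-comm p m) (sym n≡m*p))

module Orthomorphism (N : ℕ) (σ : ℕ → ℕ) (orth : IsMultOrthomorphism (suc N) σ) where

  n : ℕ
  n = suc N

  f : ℕ → ℕ
  f x = (x * σ x) % n

  σ-injection : IsInjectionOn n σ
  σ-injection = bijection⇒injection (proj₁ orth)

  f-injection : IsInjectionOn n f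
  f-injection = bijection⇒injection (proj₂ orth)

  -- A divisor q of n divides x iff it divides σ x iff it divides f x.  The implications
  -- towards f x are clear; the converses follow by counting.
  module Divisor {q} (q∣n : q ∣ n) where

    x⇒f : ∀ {x} → q ∣ x → q ∣ f x
    x⇒f {x} q∣x = %-presˡ-∣ (∣m⇒∣m*n (σ x) q∣x) q∣n

    σ⇒f : ∀ {x} → q ∣ σ x → q ∣ f x
    σ⇒f {x} q∣σx = %-presˡ-∣ (∣n⇒∣m*n x q∣σx) q∣n

    f⇒x : ∀ x → InRange n x → q ∣ f x → q ∣ x
    f⇒x = counting-converse N (q ∣?_) (identity-injection n) f-injection (λ _ _ → x⇒f)

    f⇒σ : ∀ x → InRange n x → q ∣ f x → q ∣ σ x
    f⇒σ = counting-converse N (q ∣?_) σ-injection f-injection (λ _ _ → σ⇒f)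

    x⇒σ : ∀ x → InRange n x → q ∣ x → q ∣ σ x
    x⇒σ x r q∣x = f⇒σ x r (x⇒f q∣x)

    σ⇒x : ∀ x → InRange n x → q ∣ σ x → q ∣ x
    σ⇒x x r q∣σx = f⇒x x r (σ⇒f q∣σx)

  -- n = q m with 2 ≤ q ∣ m is impossible: then q ∣ σ m, so n = q m divides m σ(m) and f m = 0.
  no-squareful-shape : ∀ {q m} → 2 ≤ q → q ∣ m → q * m ≡ n → ⊥
  no-squareful-shape {q} {zero} _ _ qm≡n = contradiction (trans (sym qm≡n) (*-zeroʳ q)) (λ ())
  no-squareful-shape {q} {m@(suc _)} 2≤q q∣m qm≡n = contradiction f-m≡0 f-m≢0
    where
    m-inRange : InRange n m
    m-inRange = s≤s z≤n , subst (m <_) (trans (*-comm m q) qm≡n) (m<m*n m q 2≤q)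
    n∣mσm : n ∣ m * σ m
    n∣mσm = subst₂ _∣_ qm≡n (*-comm (σ m) m) (*-pres-∣ (Divisor.x⇒σ (divides m (sym (trans (*-comm m q) qm≡n))) m m-inRange q∣m) (∣-refl {m}))
    f-m≢0 : f m ≢ 0
    f-m≢0 eq = <⇒≢ (proj₁ (proj₁ f-injection m m-inRange)) (sym eq)
    f-m≡0 : f m ≡ 0
    f-m≡0 = n∣m⇒m%n≡0 (m * σ m) n n∣mσm

  -- For m ∣ n, the product Z of the multiples of m in {1,…,N} satisfies Z ≡ Z² (mod n):
  -- reindex it along f and along σ, using onMultiples m (f x) ≡ onMultiples m x · onMultiples m (σ x).
  module MultiplesProduct {m} (m∣n : m ∣ n) where
    open Divisor m∣n

    onMultiples-f : ∀ x → InRange n x → onMultiples m (f x) % n ≡ (onMultiples m x * onMultiples m (σ x)) % n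
    onMultiples-f x r = by-cases (m ∣? x)
      where
      open ≡-Reasoning
      by-cases : Dec (m ∣ x) → onMultiples m (f x) % n ≡ (onMultiples m x * onMultiples m (σ x)) % n
      by-cases (yes m∣x) = begin
        onMultiples m (f x) % n                       ≡⟨ cong (_% n) (onMultiples-yes (x⇒f m∣x)) ⟩
        f x % n                                       ≡⟨ m%n%n≡m%n (x * σ x) n ⟩
        (x * σ x) % n                                 ≡⟨ cong₂ (λ u v → (u * v) % n) (sym (onMultiples-yes m∣x))
                                                                                    (sym (onMultiples-yes (x⇒σ x r m∣x))) ⟩
        (onMultiples m x * onMultiples m (σ x)) % n   ∎
      by-cases (no m∤x) = begin
        onMultiples m (f x) % n                       ≡⟨ cong (_% n) (onMultiples-no (λ m∣fx → m∤x (f⇒x x r m∣fx))) ⟩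
        1 % n                                         ≡⟨ cong₂ (λ u v → (u * v) % n) (sym (onMultiples-no m∤x))
                                                                 (sym (onMultiples-no (λ m∣σx → m∤x (σ⇒x x r m∣σx)))) ⟩
        (onMultiples m x * onMultiples m (σ x)) % n   ∎

    Z : ℕ
    Z = ∏ N (onMultiples m)

    Z-idempotent : Z % n ≡ (Z * Z) % n
    Z-idempotent = begin
      Z % n                                                    ≡⟨ cong (_% n) (sym (∏.reindex N f-injection (onMultiples m))) ⟩
      ∏ N (λ x → onMultiples m (f x)) % n                      ≡⟨ ∏-cong-mod n N onMultiples-f ⟩
      ∏ N (λ x → onMultiples m x * onMultiples m (σ x)) % n    ≡⟨ cong (_% n) (∏.distrib N (onMultiples m) (λ x → onMultiples m (σ x))) ⟩
      (Z * ∏ N (λ x → onMultiples m (σ x))) % n                ≡⟨ cong (λ t → (Z * t) % n) (∏.reindex N σ-injection (onMultiples m)) ⟩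
      (Z * Z) % n                                              ∎
      where open ≡-Reasoning

  -- n = p m with p an odd prime not dividing m is impossible: modulo p we have Z ≡ Z²,
  -- while Z = ∏_{j < p} j m ≡ (p − 1)! ≡ −1 by scaling and Wilson's theorem.
  no-odd-prime-shape : ∀ {p m} → Prime p → 3 ≤ p → ¬ p ∣ m → p * m ≡ n → ⊥
  no-odd-prime-shape {p} {zero} _ _ _ pm≡n = contradiction (trans (sym pm≡n) (*-zeroʳ p)) (λ ())
  no-odd-prime-shape {m = suc m′} p-prime (s≤s (s≤s (s≤s {n = M} _))) p∤m pm≡n =
    P≢1 (minus-one-idempotent Z Z≡-1 Z≡Z²)
    where
    open ModPrime (suc M) p-prime
    open MultiplesProduct {suc m′} (divides p (sym pm≡n))
    P≢1 : P ≢ 1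
    P≢1 ()
    Z≡Z² : Z % p ≡ (Z * Z) % p
    Z≡Z² = %≡-divisor (divides (suc m′) (trans (sym pm≡n) (*-comm p (suc m′)))) {Z} {Z * Z} Z-idempotent
    N≡Pm+m′ : N ≡ P * suc m′ + m′
    N≡Pm+m′ = trans (suc-injective (sym pm≡n)) (+-comm m′ (P * suc m′))
    Z≡-1 : Z % p ≡ P % p
    Z≡-1 = begin
      Z % p                                         ≡⟨ cong (λ t → ∏ t (onMultiples (suc m′)) % p) N≡Pm+m′ ⟩
      ∏ (P * suc m′ + m′) (onMultiples (suc m′)) % p ≡⟨ cong (_% p) (trans (Multiples.∏-tail m′ P m′ ≤-refl)
                                                                           (Multiples.∏-multiples m′ P)) ⟩
      ∏ P (λ j → j * suc m′) % p                    ≡⟨ ∏-scaled p∤m ⟩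
      ∏ P (λ j → j) % p                             ≡⟨ wilson ⟩
      P % p                                         ∎
      where open ≡-Reasoning

  n<3 : 3 ≤ n → ⊥
  n<3 3≤n with shape n 3≤n
  ... | squareful 2≤q q∣m qm≡n = no-squareful-shape 2≤q q∣m qm≡n
  ... | odd-prime-part p-prime 3≤p p∤m pm≡n = no-odd-prime-shape p-prime 3≤p p∤m pm≡n

theorem1p3 : (n : ℕ) .{{_ : NonZero n}} → 2 ≤ n →
    Σ (ℕ → ℕ) (λ σ → IsMultOrthomorphism n σ) → n ≡ 2
theorem1p3 (suc N) 2≤n (σ , orth) with suc N ≟ 2
... | yes n≡2 = n≡2
... | no n≢2 = contradiction (≤∧≢⇒< 2≤n (λ 2≡n → n≢2 (sym 2≡n))) (Orthomorphism.n<3 N σ orth)
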